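{- Let $T$ be a coloured rooted tree. Let $X,Y$ be vertex automorphism orbits of $T$, and let $x_1,x_2\in X$ and $y_1,y_2\in Y$ be arbitrary. For $i=1,2$ let $z_i=x_i\wedge y_i$ be the least common ancestor of $x_i$ and $y_i$ in $T$. If $\mathrm{dist}_T(x_1,z_1)=\mathrm{dist}_T(x_2,z_2)$ and $\mathrm{dist}_T(y_1,z_1)=\mathrm{dist}_T(y_2,z_2)$, then there is an automorphism of $T$ mapping $x_1$ to $x_2$ and $y_1$ to $y_2$.
   Context: A coloured rooted tree is a finite rooted tree each of whose nodes carries a colour. An automorphism of $T$ is a bijection $V(T)\to V(T)$ preserving adjacency, the root, and the colours of all nodes. The vertex automorphism orbits are the equivalence classes of the relation $x\sim x'$ iff some automorphism maps $x$ to $x'$. $\mathrm{dist}_T$ is the distance in $T$; a node is an ancestor of another if it lies on the path from that node to the root (every node is its own ancestor). -}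

module Defs where

open import Data.Nat using (ℕ; zero; suc; _≤_)
open import Data.Fin using (Fin)
open import Data.Maybe using (Maybe; just; nothing; _>>=_)
open import Data.Product using (Σ; ∃; _×_; _,_)
open import Data.Sum using (_⊎_)
open import Relation.Binary.PropositionalEquality using (_≡_)
open import Function.Bundles using (_↔_; Inverse; _⇔_)

-- The root has no parent, and every vertex reaches the root by
-- iterating the parent map (this forces acyclicity and connectedness,
-- and makes the root the unique parentless vertex).
-- k-fold application of a parent map
iterParent : {n : ℕ} → (Fin n → Maybe (Fin n)) → ℕ → Fin n → Maybe (Fin n)
iterParent p zero    x = just x
iterParent p (suc k) x = p x >>= iterParent p k

record RootedTree (n : ℕ) : Set where
  field
    parent : Fin n → Maybe (Fin n)
    root   : Fin n
    root-parent : parent root ≡ nothing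
    reaches-root : (x : Fin n) → ∃ λ k → iterParent parent k x ≡ just root

  up : ℕ → Fin n → Maybe (Fin n)
  up = iterParent parent

  Adj : Fin n → Fin n → Set
  Adj x y = (parent x ≡ just y) ⊎ (parent y ≡ just x)

  data Walk : ℕ → Fin n → Fin n → Set where
    [] : ∀ {x} → Walk zero x x
    _∷_ : ∀ {k x y w} → Adj x y → Walk k y w → Walk (suc k) x w

  Dist : Fin n → Fin n → ℕ → Set
  Dist x y d = Walk d x y × (∀ m → Walk m x y → d ≤ m)

  -- z is an ancestor of x (z lies on the path from x to the root;
  -- every node is its own ancestor)
  Ancestor : Fin n → Fin n → Set
  Ancestor z x = ∃ λ k → up k x ≡ just z

  IsLCA : Fin n → Fin n → Fin n → Set
  IsLCA z x y = Ancestor z x × Ancestor z y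
              × (∀ w → Ancestor w x → Ancestor w y → Ancestor w z)

record ColouredRootedTree (C : Set) (n : ℕ) : Set where
  field
    tree   : RootedTree n
    colour : Fin n → C
  open RootedTree tree public

module _ {C : Set} {n : ℕ} (T : ColouredRootedTree C n) where
  open ColouredRootedTree T

  record Automorphism : Set where
    field
      perm        : Fin n ↔ Fin n
      pres-adj    : ∀ x y → Adj x y ⇔ Adj (Inverse.to perm x) (Inverse.to perm y)
      pres-root   : Inverse.to perm root ≡ root
      pres-colour : ∀ x → colour (Inverse.to perm x) ≡ colour x
    σ : Fin n → Fin n
    σ = Inverse.to perm

  SameOrbit : Fin n → Fin n → Set
  SameOrbit x x' = Σ Automorphism λ φ → Automorphism.σ φ x ≡ x'

module Submission where

-- Let φ, ψ be automorphisms with φ x₁ = x₂ and ψ y₁ = y₂.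
-- Distances to ancestors count parent steps, so φ maps z₁ to z₂; if y₁ = z₁
-- we are done.  Otherwise let cᵢ be the child of zᵢ above yᵢ.  The
-- automorphism χ = ψ ∘ φ⁻¹ sends φ y₁ to y₂, hence the sibling φ c₁ of c₂
-- to c₂.  Applying χ below φ c₁, χ⁻¹ below c₂ and the identity elsewhere
-- gives an automorphism θ; then θ ∘ φ sends y₁ to y₂ and still x₁ to x₂,
-- as x₂ lies below neither child (both are children of an LCA on the y-side).

open import Defs
open import Data.Nat using (ℕ; zero; suc; _+_; _≤_; _∸_; s≤s)
open import Data.Nat.Properties
  using (≤-antisym; ≤-trans; ≤-reflexive; m≤n+m; n≤1+n; +-cancelʳ-≤; +-cancelʳ-≡; m+n∸n≡m; <⇒≱; ≤-refl)
open import Data.Fin using (Fin) renaming (_≟_ to _≟ᶠ_)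
open import Data.Maybe using (just; nothing; _>>=_) renaming (map to mapᵐ)
open import Data.Maybe.Properties using (just-injective; ≡-dec)
open import Data.Product using (Σ; _×_; _,_; proj₁; proj₂)
open import Data.Sum using (_⊎_; inj₁; inj₂)
open import Data.Empty using (⊥-elim)
open import Relation.Nullary using (¬_; Dec; yes; no)
open import Relation.Binary.PropositionalEquality
open import Function.Base using (_∘_)
open import Function.Bundles using (Inverse; Equivalence; mk⇔; mk↔ₛ′)

module TreeFacts {n : ℕ} (T : RootedTree n) where
  open RootedTree T

  up-+ : ∀ k j x → up (k + j) x ≡ (up k x >>= up j)
  up-+ zero    j x = refl
  up-+ (suc k) j x with parent x
  ... | nothing = refl
  ... | just p  = up-+ k j p

  steps-to-root-unique : ∀ a b x → up a x ≡ just root → up b x ≡ just root → a ≡ b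
  steps-to-root-unique zero    zero    x ha hb = refl
  steps-to-root-unique zero    (suc b) x ha hb
    rewrite just-injective ha | root-parent with hb
  ... | ()
  steps-to-root-unique (suc a) zero    x ha hb
    rewrite just-injective hb | root-parent with ha
  ... | ()
  steps-to-root-unique (suc a) (suc b) x ha hb with parent x
  steps-to-root-unique (suc a) (suc b) x () hb | nothing
  ... | just p = cong suc (steps-to-root-unique a b p ha hb)

  depth : Fin n → ℕ
  depth x = proj₁ (reaches-root x)

  depth-up : ∀ k x c → up k x ≡ just c → depth x ≡ k + depth c
  depth-up k x c h = steps-to-root-unique _ _ x (proj₂ (reaches-root x)) via-c
    where
      via-c : up (k + depth c) x ≡ just root
      via-c = begin
        up (k + depth c) x          ≡⟨ up-+ k (depth c) x ⟩
        (up k x >>= up (depth c))   ≡⟨ cong (_>>= up (depth c)) h ⟩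
        up (depth c) c              ≡⟨ proj₂ (reaches-root c) ⟩
        just root                   ∎
        where open ≡-Reasoning

  parent-depth : ∀ {x y} → parent x ≡ just y → depth x ≡ suc (depth y)
  parent-depth {x} {y} e = depth-up 1 x y one-step
    where
      one-step : (parent x >>= just) ≡ just y
      one-step rewrite e = refl

  ancestor-depth : ∀ {c v} → Ancestor c v → depth c ≤ depth v
  ancestor-depth {c} {v} (k , h) rewrite depth-up k v c h = m≤n+m (depth c) k

  parent-not-descendant : ∀ {a z} → parent a ≡ just z → ¬ Ancestor a z
  parent-not-descendant e anc =
    <⇒≱ (≤-reflexive (sym (parent-depth e))) (ancestor-depth anc)

  same-depth-ancestors : ∀ {a b v} → depth a ≡ depth b →
                         Ancestor a v → Ancestor b v → a ≡ b
  same-depth-ancestors {a} {b} {v} da≡db (k , ha) (k' , hb) =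
    just-injective (trans (sym ha) (subst (λ j → up j v ≡ just b) (sym k≡k') hb))
    where
      k≡k' : k ≡ k'
      k≡k' = +-cancelʳ-≡ (depth a) k k'
        (trans (sym (depth-up k v a ha)) (trans (depth-up k' v b hb) (cong (k' +_) (sym da≡db))))

  siblings-disjoint : ∀ {a b z v} → parent a ≡ just z → parent b ≡ just z →
                      Ancestor a v → Ancestor b v → a ≡ b
  siblings-disjoint pa pb =
    same-depth-ancestors (trans (parent-depth pa) (sym (parent-depth pb)))

  -- Being an ancestor is decidable: only the depth difference can work.
  ancestor? : ∀ c v → Dec (Ancestor c v)
  ancestor? c v with ≡-dec _≟ᶠ_ (up (depth v ∸ depth c) v) (just c)
  ... | yes h = yes (depth v ∸ depth c , h)
  ... | no ¬h = no λ (k , h) → ¬h (subst (λ j → up j v ≡ just c) (steps k h) h)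
    where
      steps : ∀ k → up k v ≡ just c → k ≡ depth v ∸ depth c
      steps k h = sym (trans (cong (_∸ depth c) (depth-up k v c h)) (m+n∸n≡m k (depth c)))

  ancestor-of-child : ∀ {c v p} → parent v ≡ just p → Ancestor c v →
                      v ≡ c ⊎ Ancestor c p
  ancestor-of-child e (zero  , h) = inj₁ (just-injective h)
  ancestor-of-child e (suc k , h) rewrite e = inj₂ (k , h)

  ancestor-of-parent : ∀ {c v p} → parent v ≡ just p → Ancestor c p → Ancestor c v
  ancestor-of-parent e (k , h) = suc k , trans (cong (_>>= up k) e) h

  data Region (a b v : Fin n) : Set where
    below-a   : Ancestor a v → Region a b v
    below-b   : ¬ Ancestor a v → Ancestor b v → Region a b v
    elsewhere : ¬ Ancestor a v → ¬ Ancestor b v → Region a b v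

  region : ∀ a b v → Region a b v
  region a b v with ancestor? a v | ancestor? b v
  ... | yes A | _     = below-a A
  ... | no ¬A | yes B = below-b ¬A B
  ... | no ¬A | no ¬B = elsewhere ¬A ¬B

  up-suc : ∀ k y z → up (suc k) y ≡ just z →
           Σ (Fin n) λ c → (up k y ≡ just c) × (parent c ≡ just z)
  up-suc k y z h with parent y in e
  up-suc k y z () | nothing
  up-suc zero    y z h | just p = y , refl , trans e h
  up-suc (suc k) y z h | just p with up-suc k p z h
  ... | c , hc , pc = c , trans (cong (_>>= up k) e) hc , pc

  parentless-is-root : ∀ v → parent v ≡ nothing → v ≡ root
  parentless-is-root v e with reaches-root v
  ... | zero  , h = just-injective h
  ... | suc k , h rewrite e with h
  ... | ()

  up-walk : ∀ k x z → up k x ≡ just z → Walk k x z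
  up-walk zero    x z h rewrite just-injective h = []
  up-walk (suc k) x z h with parent x in e
  up-walk (suc k) x z () | nothing
  ... | just p = inj₁ e ∷ up-walk k p z h

  adjacent-depth : ∀ {x y} → Adj x y → depth x ≤ suc (depth y)
  adjacent-depth (inj₁ e) = ≤-reflexive (parent-depth e)
  adjacent-depth (inj₂ e) rewrite parent-depth e = ≤-trans (n≤1+n _) (n≤1+n _)

  walk-depth : ∀ {m x y} → Walk m x y → depth x ≤ m + depth y
  walk-depth []       = ≤-refl
  walk-depth (a ∷ ws) = ≤-trans (adjacent-depth a) (s≤s (walk-depth ws))

  dist-to-ancestor : ∀ {x z d} → Dist x z d → Ancestor z x → up d x ≡ just z
  dist-to-ancestor {x} {z} {d} (walk , shortest) (k , h) =
    subst (λ j → up j x ≡ just z) (≤-antisym k≤d (shortest k (up-walk k x z h))) h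
    where
      k≤d : k ≤ d
      k≤d = +-cancelʳ-≤ (depth z) k d
              (subst (_≤ d + depth z) (depth-up k x z h) (walk-depth walk))

  lca-child-not-above : ∀ {c z x y} → parent c ≡ just z → IsLCA z x y →
                        Ancestor c y → ¬ Ancestor c x
  lca-child-not-above pc (_ , _ , least) cy cx = parent-not-descendant pc (least _ cx cy)

  PreservesParent : (Fin n → Fin n) → Set
  PreservesParent f = ∀ x → parent (f x) ≡ mapᵐ f (parent x)

  up-map : ∀ {f} → PreservesParent f → ∀ k x → up k (f x) ≡ mapᵐ f (up k x)
  up-map pf zero    x = refl
  up-map pf (suc k) x rewrite pf x with parent x
  ... | nothing = refl
  ... | just p  = up-map pf k p

  up-map-just : ∀ {f} → PreservesParent f → ∀ {k v w} → up k v ≡ just w → up k (f v) ≡ just (f w)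
  up-map-just pf {k} {v} h = trans (up-map pf k v) (cong (mapᵐ _) h)

  ancestor-map : ∀ {f} → PreservesParent f → ∀ {c v} → Ancestor c v → Ancestor (f c) (f v)
  ancestor-map pf (k , h) = k , up-map-just pf {k} h

  preserves-parent-∘ : ∀ {f g} → PreservesParent f → PreservesParent g →
                       PreservesParent (λ x → f (g x))
  preserves-parent-∘ {g = g} pf pg x rewrite pf (g x) | pg x with parent x
  ... | nothing = refl
  ... | just p  = refl

  preserves-parent-inverse : ∀ {f g} → (∀ y → f (g y) ≡ y) → (∀ x → g (f x) ≡ x) →
                             PreservesParent f → PreservesParent g
  preserves-parent-inverse {f} {g} fg gf pf y
    with parent (g y) | trans (sym (cong parent (fg y))) (pf (g y))
  ... | nothing | r rewrite r = refl
  ... | just q  | r rewrite r = cong just (sym (gf q))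

-- Symmetries of a coloured rooted tree: parent- and colour-preserving
-- bijections, given with their inverse.  They are exactly the automorphisms.
module Symmetries {C : Set} {n : ℕ} (T : ColouredRootedTree C n) where
  open ColouredRootedTree T
  open TreeFacts tree

  record Symmetry : Set where
    field
      to        : Fin n → Fin n
      from      : Fin n → Fin n
      to-from   : ∀ y → to (from y) ≡ y
      from-to   : ∀ x → from (to x) ≡ x
      to-parent : PreservesParent to
      to-colour : ∀ x → colour (to x) ≡ colour x

  open Symmetry public

  -- By induction on the
  -- distance to the root: σ x is adjacent to σ p for the parent p of x, and
  -- σ p cannot be the child of σ x, since by induction its parent is σ of
  -- the parent of p, and p is neither parentless nor the child of x.
  module _ (φ : Automorphism T) where
    open Automorphism φ

    private
      σ-injective : ∀ {a b} → σ a ≡ σ b → a ≡ b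
      σ-injective {a} {b} e = trans (sym (Inverse.strictlyInverseʳ perm a))
        (trans (cong (Inverse.from perm) e) (Inverse.strictlyInverseʳ perm b))

    automorphism-parent : ∀ k x → up k x ≡ just root → parent (σ x) ≡ mapᵐ σ (parent x)
    automorphism-parent zero x h rewrite just-injective h | pres-root | root-parent = refl
    automorphism-parent (suc k) x h with parent x in e
    automorphism-parent (suc k) x () | nothing
    ... | just p with Equivalence.to (pres-adj x p) (inj₁ e)
    ...   | inj₁ σp-parent = σp-parent
    ...   | inj₂ σx-parent with parent p in e' | automorphism-parent k p h
    ...     | nothing | r with trans (sym σx-parent) r
    ...       | ()
    automorphism-parent (suc k) x h | just p | inj₂ σx-parent | just q | r
      rewrite σ-injective (just-injective (trans (sym r) σx-parent)) =
        ⊥-elim (parent-not-descendant e (ancestor-of-parent e' (0 , refl)))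

    fromAutomorphism : Symmetry
    fromAutomorphism = record
      { to        = σ
      ; from      = Inverse.from perm
      ; to-from   = Inverse.strictlyInverseˡ perm
      ; from-to   = Inverse.strictlyInverseʳ perm
      ; to-parent = λ x → automorphism-parent (depth x) x (proj₂ (reaches-root x))
      ; to-colour = pres-colour
      }

  inverse-parent : (f : Symmetry) → PreservesParent (from f)
  inverse-parent f = preserves-parent-inverse (to-from f) (from-to f) (to-parent f)

  toAutomorphism : Symmetry → Automorphism T
  toAutomorphism f = record
    { perm        = mk↔ₛ′ (to f) (from f) (to-from f) (from-to f)
    ; pres-adj    = λ x y → mk⇔ (adj-to x y) (adj-from x y)
    ; pres-root   = parentless-is-root (to f root)
                      (trans (to-parent f root) (cong (mapᵐ (to f)) root-parent))
    ; pres-colour = to-colour f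
    }
    where
      parent-to : ∀ {x y} → parent x ≡ just y → parent (to f x) ≡ just (to f y)
      parent-to {x} e = trans (to-parent f x) (cong (mapᵐ (to f)) e)

      parent-from : ∀ {x y} → parent (to f x) ≡ just (to f y) → parent x ≡ just y
      parent-from {x} {y} e = begin
        parent x                         ≡⟨ cong parent (sym (from-to f x)) ⟩
        parent (from f (to f x))         ≡⟨ inverse-parent f (to f x) ⟩
        mapᵐ (from f) (parent (to f x))  ≡⟨ cong (mapᵐ (from f)) e ⟩
        just (from f (to f y))           ≡⟨ cong just (from-to f y) ⟩
        just y                           ∎
        where open ≡-Reasoning

      adj-to : ∀ x y → Adj x y → Adj (to f x) (to f y)
      adj-to x y (inj₁ e) = inj₁ (parent-to e)
      adj-to x y (inj₂ e) = inj₂ (parent-to e)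

      adj-from : ∀ x y → Adj (to f x) (to f y) → Adj x y
      adj-from x y (inj₁ e) = inj₁ (parent-from e)
      adj-from x y (inj₂ e) = inj₂ (parent-from e)

  _⁻¹ : Symmetry → Symmetry
  f ⁻¹ = record
    { to        = from f
    ; from      = to f
    ; to-from   = from-to f
    ; from-to   = to-from f
    ; to-parent = inverse-parent f
    ; to-colour = λ y → trans (sym (to-colour f (from f y))) (cong colour (to-from f y))
    }

  _∘ˢ_ : Symmetry → Symmetry → Symmetry
  f ∘ˢ g = record
    { to        = λ x → to f (to g x)
    ; from      = λ y → from g (from f y)
    ; to-from   = λ y → trans (cong (to f) (to-from g (from f y))) (to-from f y)
    ; from-to   = λ x → trans (cong (from g) (from-to f (to g x))) (from-to g x)
    ; to-parent = preserves-parent-∘ (to-parent f) (to-parent g)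
    ; to-colour = λ x → trans (to-colour f (to g x)) (to-colour g x)
    }

  ancestor-reflect : (f : Symmetry) → ∀ {c v} → Ancestor (to f c) (to f v) → Ancestor c v
  ancestor-reflect f {c} {v} anc =
    subst₂ Ancestor (from-to f c) (from-to f v) (ancestor-map (inverse-parent f) anc)

  maps-ancestor : (f : Symmetry) → ∀ {k x₁ x₂ z₁ z₂} → to f x₁ ≡ x₂ →
                  up k x₁ ≡ just z₁ → up k x₂ ≡ just z₂ → to f z₁ ≡ z₂
  maps-ancestor f {k} fx h₁ h₂ =
    just-injective (trans (sym (up-map-just (to-parent f) {k} h₁)) (trans (cong (up k) fx) h₂))

  graft : (Fin n → Fin n) → (Fin n → Fin n) → Fin n → Fin n → Fin n → Fin n
  graft f g a b v with ancestor? a v | ancestor? b v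
  ... | yes _ | _     = f v
  ... | no _  | yes _ = g v
  ... | no _  | no _  = v

  graft-in-a : ∀ {f g a b v} → Ancestor a v → graft f g a b v ≡ f v
  graft-in-a {a = a} {b} {v} A with ancestor? a v | ancestor? b v
  ... | yes _ | _ = refl
  ... | no ¬A | _ = ⊥-elim (¬A A)

  graft-in-b : ∀ {f g a b v} → ¬ Ancestor a v → Ancestor b v → graft f g a b v ≡ g v
  graft-in-b {a = a} {b} {v} ¬A B with ancestor? a v | ancestor? b v
  ... | yes A | _     = ⊥-elim (¬A A)
  ... | no _  | yes _ = refl
  ... | no _  | no ¬B = ⊥-elim (¬B B)

  graft-outside : ∀ {f g a b v} → ¬ Ancestor a v → ¬ Ancestor b v → graft f g a b v ≡ v
  graft-outside {a = a} {b} {v} ¬A ¬B with ancestor? a v | ancestor? b v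
  ... | yes A | _     = ⊥-elim (¬A A)
  ... | no _  | yes B = ⊥-elim (¬B B)
  ... | no _  | no _  = refl

  -- Exchanging sibling subtrees: if a and b are children of z and the
  -- symmetry f sends a to b, then f on the subtree of a, f⁻¹ on that of b
  -- and the identity elsewhere is again a symmetry.  (The case a = b is
  -- allowed; then f is simply applied below a.)
  module SiblingSwap (f : Symmetry) {a b z : Fin n}
                     (a-child : parent a ≡ just z) (b-child : parent b ≡ just z)
                     (f-a : to f a ≡ b) where

    exchange : Fin n → Fin n
    exchange = graft (to f) (from f) a b

    from-b : from f b ≡ a
    from-b = trans (cong (from f) (sym f-a)) (from-to f a)

    f-z : to f z ≡ z
    f-z = just-injective (begin
      just (to f z)           ≡⟨ cong (mapᵐ (to f)) (sym a-child) ⟩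
      mapᵐ (to f) (parent a)  ≡⟨ sym (to-parent f a) ⟩
      parent (to f a)         ≡⟨ cong parent f-a ⟩
      parent b                ≡⟨ b-child ⟩
      just z                  ∎)
      where open ≡-Reasoning

    from-z : from f z ≡ z
    from-z = trans (cong (from f) (sym f-z)) (from-to f z)

    exchange-z : exchange z ≡ z
    exchange-z = graft-outside (parent-not-descendant a-child) (parent-not-descendant b-child)

    into-b : ∀ {v} → Ancestor a v → Ancestor b (to f v)
    into-b A = subst (λ c → Ancestor c _) f-a (ancestor-map (to-parent f) A)

    into-a : ∀ {v} → Ancestor b v → Ancestor a (from f v)
    into-a B = subst (λ c → Ancestor c _) from-b (ancestor-map (inverse-parent f) B)

    disjoint : ∀ {v} → ¬ Ancestor a v → Ancestor b v →
               ∀ {u} → Ancestor b u → ¬ Ancestor a u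
    disjoint ¬Av Bv Bu Au =
      ¬Av (subst (λ c → Ancestor c _) (sym (siblings-disjoint a-child b-child Au Bu)) Bv)

    exchange-cancel : ∀ v → graft (from f) (to f) b a (exchange v) ≡ v
    exchange-cancel v with region a b v
    ... | below-a A = begin
      graft (from f) (to f) b a (exchange v)  ≡⟨ cong (graft (from f) (to f) b a) (graft-in-a A) ⟩
      graft (from f) (to f) b a (to f v)      ≡⟨ graft-in-a (into-b A) ⟩
      from f (to f v)                         ≡⟨ from-to f v ⟩
      v                                       ∎
      where open ≡-Reasoning
    ... | below-b ¬A B = begin
      graft (from f) (to f) b a (exchange v)  ≡⟨ cong (graft (from f) (to f) b a) (graft-in-b ¬A B) ⟩
      graft (from f) (to f) b a (from f v)    ≡⟨ graft-in-b (λ B′ → disjoint ¬A B B′ (into-a B)) (into-a B) ⟩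
      to f (from f v)                         ≡⟨ to-from f v ⟩
      v                                       ∎
      where open ≡-Reasoning
    ... | elsewhere ¬A ¬B =
      trans (cong (graft (from f) (to f) b a) (graft-outside ¬A ¬B)) (graft-outside ¬B ¬A)

    subtree-parent : ∀ {h r v} → PreservesParent h → parent r ≡ just z → h z ≡ z →
                     (∀ {u} → Ancestor r u → exchange u ≡ h u) → Ancestor r v →
                     parent (exchange v) ≡ mapᵐ exchange (parent v)
    subtree-parent {h} {r} {v} h-parent r-child h-z agree Rv =
      trans (cong parent (agree Rv)) (trans (h-parent v) (on-parent (parent v) refl))
      where
        on-parent : ∀ m → parent v ≡ m → mapᵐ h m ≡ mapᵐ exchange m
        on-parent nothing  _ = refl
        on-parent (just p) e with ancestor-of-child e Rv
        ... | inj₂ Rp   = cong just (sym (agree Rp))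
        ... | inj₁ refl rewrite just-injective (trans (sym e) r-child) =
          cong just (trans h-z (sym exchange-z))

    exchange-parent : PreservesParent exchange
    exchange-parent v with region a b v
    ... | below-a A      = subtree-parent (to-parent f) a-child f-z graft-in-a A
    ... | below-b ¬A B   = subtree-parent (inverse-parent f) b-child from-z
                            (λ Bu → graft-in-b (disjoint ¬A B Bu) Bu) B
    ... | elsewhere ¬A ¬B =
      trans (cong parent (graft-outside ¬A ¬B)) (fixed-parent (parent v) refl)
      where
        fixed-parent : ∀ m → parent v ≡ m → m ≡ mapᵐ exchange m
        fixed-parent nothing  _ = refl
        fixed-parent (just p) e = cong just (sym (graft-outside
          (¬A ∘ ancestor-of-parent e) (¬B ∘ ancestor-of-parent e)))

    exchange-colour : ∀ v → colour (exchange v) ≡ colour v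
    exchange-colour v with region a b v
    ... | below-a A       = trans (cong colour (graft-in-a A)) (to-colour f v)
    ... | below-b ¬A B    = trans (cong colour (graft-in-b ¬A B)) (to-colour (f ⁻¹) v)
    ... | elsewhere ¬A ¬B = cong colour (graft-outside ¬A ¬B)

  swap : (f : Symmetry) → ∀ {a b z} → parent a ≡ just z → parent b ≡ just z →
         to f a ≡ b → Symmetry
  swap f {a} {b} a-child b-child f-a = record
    { to        = exchange
    ; from      = graft (from f) (to f) b a
    ; to-from   = SiblingSwap.exchange-cancel (f ⁻¹) b-child a-child from-b
    ; from-to   = exchange-cancel
    ; to-parent = exchange-parent
    ; to-colour = exchange-colour
    }
    where open SiblingSwap f a-child b-child f-a

  -- The theorem for symmetries, with the distances to the LCAs replaced by
  -- numbers of parent steps; φ is assumed to send z₁ to z₂ already.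
  -- Either y₁ = z₁ and φ works, or φ is corrected by exchanging the
  -- sibling subtrees below φ(c₁) and c₂, where cᵢ is the child of zᵢ
  -- above yᵢ.
  realign : ∀ {x₁ x₂ y₁ y₂ z₁ z₂} (φ ψ : Symmetry) (e : ℕ) →
            to φ x₁ ≡ x₂ → to ψ y₁ ≡ y₂ → IsLCA z₁ x₁ y₁ → IsLCA z₂ x₂ y₂ →
            to φ z₁ ≡ z₂ → up e y₁ ≡ just z₁ → up e y₂ ≡ just z₂ →
            Σ Symmetry λ θ → (to θ x₁ ≡ x₂) × (to θ y₁ ≡ y₂)
  realign φ ψ zero φ-x ψ-y _ _ φ-z y₁-z₁ y₂-z₂
    rewrite just-injective y₁-z₁ | just-injective y₂-z₂ = φ , φ-x , φ-z
  realign {x₁} {x₂} {y₁} {y₂} {z₁} {z₂} φ ψ (suc e) φ-x ψ-y lca₁ lca₂ φ-z y₁-z₁ y₂-z₂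
    with up-suc e y₁ z₁ y₁-z₁ | up-suc e y₂ z₂ y₂-z₂
  ... | c₁ , y₁-c₁ , c₁-child | c₂ , y₂-c₂ , c₂-child = θ ∘ˢ φ , θφ-x , θφ-y
    where
      χ : Symmetry
      χ = ψ ∘ˢ (φ ⁻¹)

      χ-y : to χ (to φ y₁) ≡ y₂
      χ-y = trans (cong (to ψ) (from-to φ y₁)) ψ-y

      φy₁-φc₁ : up e (to φ y₁) ≡ just (to φ c₁)
      φy₁-φc₁ = up-map-just (to-parent φ) {e} y₁-c₁

      φc₁-child : parent (to φ c₁) ≡ just z₂
      φc₁-child = trans (to-parent φ c₁) (trans (cong (mapᵐ (to φ)) c₁-child) (cong just φ-z))

      θ : Symmetry
      θ = swap χ φc₁-child c₂-child (maps-ancestor χ {e} χ-y φy₁-φc₁ y₂-c₂)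

      x₂∉c₂ : ¬ Ancestor c₂ x₂
      x₂∉c₂ = lca-child-not-above c₂-child lca₂ (e , y₂-c₂)

      x₂∉φc₁ : ¬ Ancestor (to φ c₁) x₂
      x₂∉φc₁ A = lca-child-not-above c₁-child lca₁ (e , y₁-c₁)
                   (ancestor-reflect φ (subst (Ancestor _) (sym φ-x) A))

      θφ-x : to θ (to φ x₁) ≡ x₂
      θφ-x = trans (cong (to θ) φ-x) (graft-outside x₂∉φc₁ x₂∉c₂)

      θφ-y : to θ (to φ y₁) ≡ y₂
      θφ-y = trans (graft-in-a (e , φy₁-φc₁)) χ-y

lemma4p3 : {C : Set} {n : ℕ} (T : ColouredRootedTree C n)
    (x₁ x₂ y₁ y₂ z₁ z₂ : Fin n) →
    SameOrbit T x₁ x₂ → SameOrbit T y₁ y₂ →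
    ColouredRootedTree.IsLCA T z₁ x₁ y₁ → ColouredRootedTree.IsLCA T z₂ x₂ y₂ →
    (d e : ℕ) →
    ColouredRootedTree.Dist T x₁ z₁ d → ColouredRootedTree.Dist T x₂ z₂ d →
    ColouredRootedTree.Dist T y₁ z₁ e → ColouredRootedTree.Dist T y₂ z₂ e →
    Σ (Automorphism T) λ φ →
    (Automorphism.σ φ x₁ ≡ x₂) × (Automorphism.σ φ y₁ ≡ y₂)
lemma4p3 T x₁ x₂ y₁ y₂ z₁ z₂ (φ , φ-x) (ψ , ψ-y) lca₁ lca₂ d e
         dist-x₁ dist-x₂ dist-y₁ dist-y₂ =
  let θ , θ-x , θ-y = realign (fromAutomorphism φ) (fromAutomorphism ψ) e
                        φ-x ψ-y lca₁ lca₂ φ-z up-y₁ up-y₂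
  in  toAutomorphism θ , θ-x , θ-y
  where
    open ColouredRootedTree T using (tree; up)
    open TreeFacts tree using (dist-to-ancestor)
    open Symmetries T

    up-y₁ : up e y₁ ≡ just z₁
    up-y₁ = dist-to-ancestor dist-y₁ (proj₁ (proj₂ lca₁))

    up-y₂ : up e y₂ ≡ just z₂
    up-y₂ = dist-to-ancestor dist-y₂ (proj₁ (proj₂ lca₂))

    φ-z : Automorphism.σ φ z₁ ≡ z₂
    φ-z = maps-ancestor (fromAutomorphism φ) {d} φ-x
            (dist-to-ancestor dist-x₁ (proj₁ lca₁)) (dist-to-ancestor dist-x₂ (proj₁ lca₂))
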